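{- Let $k\ge 1$ and $n\ge 2k+1$. Then $\chi_{CF\text{ - }CN}(K(n,k))\le k+1$.
   Context: The Kneser graph $K(n,k)$ has as vertices the $k$-element subsets of $\{1,\dots,n\}$, two being adjacent iff they are disjoint. A conflict-free closed neighborhood coloring of a graph $G$ with $m$ colors is a map $C:V(G)\to\{1,\dots,m\}$ such that for every vertex $v$ there is a color $i$ with $|N[v]\cap C^{ -1}(i)|=1$, where $N[v]=N(v)\cup\{v\}$ is the closed neighborhood. $\chi_{CF\text{ - }CN}(G)$ denotes the minimum such $m$. -}

module Defs where

open import Data.Nat using (ℕ; suc; _≤_; _+_; _*_)
open import Data.Fin using (Fin)
open import Data.Fin.Subset using (Subset; ∣_∣; _∩_; Empty)
open import Data.Product using (Σ; ∃; _×_; proj₁)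
open import Data.Sum using (_⊎_)
open import Relation.Binary.PropositionalEquality using (_≡_)

KVertex : ℕ → ℕ → Set
KVertex n k = Σ (Subset n) (λ s → ∣ s ∣ ≡ k)

KAdj : ∀ {n k} → KVertex n k → KVertex n k → Set
KAdj u v = Empty (proj₁ u ∩ proj₁ v)

_≈V_ : ∀ {n k} → KVertex n k → KVertex n k → Set
u ≈V v = proj₁ u ≡ proj₁ v

InClosedNbhd : ∀ {n k} → KVertex n k → KVertex n k → Set
InClosedNbhd u v = u ≈V v ⊎ KAdj u v

IsCFCNColoring : ∀ {n k m} → (KVertex n k → Fin m) → Set
IsCFCNColoring {n} {k} {m} C =
  (v : KVertex n k) → ∃ λ (i : Fin m) → ∃ λ (u : KVertex n k) →
    InClosedNbhd u v × C u ≡ i ×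
    ((w : KVertex n k) → InClosedNbhd w v → C w ≡ i → w ≈V u)

χCFCN-K≤ : ℕ → ℕ → ℕ → Set
χCFCN-K≤ n k m = ∃ λ (C : KVertex n k → Fin m) → IsCFCNColoring C

-- Identify {1,…,n} with Fin n and let top(s) be one more than the largest
-- element of s (0 for the empty set).  A k-set v has top(v) ≥ k; colour it by
-- its level  min(top(v) − k, k) ∈ {0,…,k}.
--  * Low vertices (top(v) ≤ 2k−1) get pairwise distinct colours for distinct
--    tops, and two disjoint sets never share their top, so v is the only
--    vertex of N[v] with its colour.
--  * A high vertex v (top(v) ≥ 2k, colour k) misses at least k of the first
--    2k−1 elements; the set W of its k smallest non-elements is a low
--    neighbour of v.  Any neighbour w of v with the colour of W has the same
--    top, hence lies inside the non-elements of v below top(W), i.e. w ⊆ W,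
--    and |w| = |W| forces w = W.  So W is uniquely coloured in N[v].
module Submission where

open import Defs
open import Data.Nat using (ℕ; zero; suc; _≤_; _<_; _+_; _*_; _∸_; _⊓_; z≤n; s≤s; _≤?_)
open import Data.Nat.Properties
open import Data.Fin using (Fin; toℕ; fromℕ<) renaming (zero to fzero; suc to fsuc)
open import Data.Fin.Properties using (toℕ-injective; fromℕ<-injective)
open import Data.Fin.Subset using (Subset; inside; outside; ⊥; ∣_∣; _∩_; Empty; _∈_; _∉_; _⊆_)
open import Data.Fin.Subset.Properties
  using (x∈p∩q⁺; x∈p∩q⁻; drop-∷-⊆; p⊆q⇒∣p∣≤∣q∣; ∉⊥; ∣⊥∣≡0; x∈p⇒∣p-x∣<∣p∣)
open import Data.Vec using (_∷_; []; here; there)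
open import Data.Bool using (Bool)
open import Data.Product using (∃; _×_; _,_; proj₁; proj₂)
open import Data.Sum using (inj₁; inj₂)
open import Relation.Nullary using (yes; no; contradiction)
open import Relation.Binary.PropositionalEquality

private variable
  n : ℕ

-- top s = 1 + max s, and 0 for the empty set.  Prepending a bit b (a new
-- least element, shifting the others up) changes the top as follows.
shiftTop : ℕ → Bool → ℕ
shiftTop zero    inside  = 1
shiftTop zero    outside = 0
shiftTop (suc m) _       = suc (suc m)

top : Subset n → ℕ
top []      = 0
top (b ∷ s) = shiftTop (top s) b

shiftTop-<⁺ : ∀ {x m} b → x < m → suc x < shiftTop m b
shiftTop-<⁺ {m = suc m} b (s≤s x≤m) = s≤s (s≤s x≤m)

shiftTop-<⁻ : ∀ {x m} b → suc x < shiftTop m b → x < m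
shiftTop-<⁻ {m = zero}  inside  (s≤s ())
shiftTop-<⁻ {m = suc m} b       (s≤s x<m) = x<m

shiftTop-≤ : ∀ {x j} b → x ≤ j → shiftTop x b ≤ suc j
shiftTop-≤ {zero}  inside  _         = s≤s z≤n
shiftTop-≤ {zero}  outside _         = z≤n
shiftTop-≤ {suc x} b       (s≤s x≤j) = s≤s (s≤s x≤j)

∈⇒<top : {s : Subset n} {i : Fin n} → i ∈ s → toℕ i < top s
∈⇒<top {s = inside ∷ t} here with top t
... | zero  = s≤s z≤n
... | suc _ = s≤s z≤n
∈⇒<top {s = b ∷ t} (there i∈t) = shiftTop-<⁺ b (∈⇒<top i∈t)

top-attained : (s : Subset n) {m : ℕ} → top s ≡ suc m → ∃ λ i → i ∈ s × toℕ i ≡ m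
top-attained (b ∷ t) {m} eq with top t in et
top-attained (inside  ∷ t) {zero}  refl | zero = fzero , here , refl
top-attained (b ∷ t) {suc m'} refl | suc m' with top-attained t et
... | i , i∈t , i≡m' = fsuc i , there i∈t , cong suc i≡m'

∣∣≤top : (s : Subset n) → ∣ s ∣ ≤ top s
∣∣≤top [] = z≤n
∣∣≤top (inside ∷ t) with top t | ∣∣≤top t
... | zero  | ∣t∣≤0    = s≤s ∣t∣≤0
... | suc _ | ∣t∣≤top  = s≤s ∣t∣≤top
∣∣≤top (outside ∷ t) with top t | ∣∣≤top t
... | zero  | ∣t∣≤0    = ∣t∣≤0
... | suc _ | ∣t∣≤top  = m≤n⇒m≤1+n ∣t∣≤top

-- Disjoint sets, one of them nonempty, have different tops: a common top
-- would be attained by a common element.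
disjoint⇒top≢ : {p q : Subset n} → Empty (p ∩ q) → 0 < top q → top p ≢ top q
disjoint⇒top≢ {q = q} p∩q≡∅ 0<top eq with top q in eq-q
... | suc m with top-attained q eq-q | top-attained _ eq
...   | i , i∈q , i≡m | j , j∈p , j≡m =
  p∩q≡∅ (i , x∈p∩q⁺ (subst (_∈ _) (toℕ-injective (trans j≡m (sym i≡m))) j∈p , i∈q))

⊆∧∣∣≡⇒≡ : {p q : Subset n} → p ⊆ q → ∣ p ∣ ≡ ∣ q ∣ → p ≡ q
⊆∧∣∣≡⇒≡ {p = []}          {[]}          _   _  = refl
⊆∧∣∣≡⇒≡ {p = outside ∷ p} {outside ∷ q} p⊆q eq = cong (outside ∷_) (⊆∧∣∣≡⇒≡ (drop-∷-⊆ p⊆q) eq)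
⊆∧∣∣≡⇒≡ {p = outside ∷ p} {inside  ∷ q} p⊆q eq =
  contradiction eq (<⇒≢ (s≤s (p⊆q⇒∣p∣≤∣q∣ (drop-∷-⊆ p⊆q))))
⊆∧∣∣≡⇒≡ {p = inside  ∷ p} {outside ∷ q} p⊆q eq with p⊆q here
... | ()
⊆∧∣∣≡⇒≡ {p = inside  ∷ p} {inside  ∷ q} p⊆q eq =
  cong (inside ∷_) (⊆∧∣∣≡⇒≡ (drop-∷-⊆ p⊆q) (suc-injective eq))

gaps : ℕ → Subset n → ℕ
gaps zero    _             = 0
gaps (suc j) []            = 0
gaps (suc j) (inside  ∷ s) = gaps j s
gaps (suc j) (outside ∷ s) = suc (gaps j s)

<top⇒<∣∣+gaps : ∀ j (s : Subset n) → j < top s → j < ∣ s ∣ + gaps j s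
<top⇒<∣∣+gaps zero s 0<top with top s in eq
... | suc _ with top-attained s eq
...   | i , i∈s , _ = subst (0 <_) (sym (+-identityʳ ∣ s ∣)) (≤-<-trans z≤n (x∈p⇒∣p-x∣<∣p∣ i∈s))
<top⇒<∣∣+gaps (suc j) (inside ∷ t) j<top =
  s≤s (<top⇒<∣∣+gaps j t (shiftTop-<⁻ inside j<top))
<top⇒<∣∣+gaps (suc j) (outside ∷ t) j<top =
  subst (suc j <_) (sym (+-suc ∣ t ∣ (gaps j t))) (s≤s (<top⇒<∣∣+gaps j t (shiftTop-<⁻ outside j<top)))

-- lowest r s: the r smallest non-elements of s (all of them if fewer).
lowest : ℕ → Subset n → Subset n
lowest zero    _             = ⊥
lowest (suc r) []            = []
lowest (suc r) (inside  ∷ s) = outside ∷ lowest (suc r) s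
lowest (suc r) (outside ∷ s) = inside  ∷ lowest r s

top-⊥ : top (⊥ {n}) ≡ 0
top-⊥ {zero}  = refl
top-⊥ {suc n} rewrite top-⊥ {n} = refl

lowest-∉ : ∀ r (s : Subset n) {i} → i ∈ lowest r s → i ∉ s
lowest-∉ zero    s                i∈ _                = ∉⊥ i∈
lowest-∉ (suc r) (inside  ∷ s)    (there i∈) (there i∈s) = lowest-∉ (suc r) s i∈ i∈s
lowest-∉ (suc r) (outside ∷ s)    (there i∈) (there i∈s) = lowest-∉ r s i∈ i∈s

lowest-disjoint : ∀ r (s : Subset n) → Empty (lowest r s ∩ s)
lowest-disjoint r s (i , i∈∩) with x∈p∩q⁻ (lowest r s) s i∈∩
... | i∈lowest , i∈s = lowest-∉ r s i∈lowest i∈s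

lowest-fits : ∀ {n} j r (s : Subset n) → r ≤ gaps j s → ∣ lowest r s ∣ ≡ r × top (lowest r s) ≤ j
lowest-fits {n} j zero s _ = ∣⊥∣≡0 n , subst (_≤ j) (sym (top-⊥ {n})) z≤n
lowest-fits (suc j) (suc r) (inside ∷ t) r≤gaps with lowest-fits j (suc r) t r≤gaps
... | size , bound = size , shiftTop-≤ outside bound
lowest-fits (suc j) (suc r) (outside ∷ t) (s≤s r≤gaps) with lowest-fits j r t r≤gaps
... | size , bound = cong suc size , shiftTop-≤ inside bound

lowest-initial : ∀ {n} r (s : Subset n) {i} → i ∉ s → toℕ i < top (lowest r s) → i ∈ lowest r s
lowest-initial {n} zero s {i} _ i<top with subst (toℕ i <_) (top-⊥ {n}) i<top
... | ()
lowest-initial (suc r) (inside ∷ t) {fzero} i∉s _ = contradiction here i∉s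
lowest-initial (suc r) (inside ∷ t) {fsuc i} i∉s i<top =
  there (lowest-initial (suc r) t (λ i∈t → i∉s (there i∈t)) (shiftTop-<⁻ outside i<top))
lowest-initial (suc r) (outside ∷ t) {fzero} _ _ = here
lowest-initial (suc r) (outside ∷ t) {fsuc i} i∉s i<top =
  there (lowest-initial r t (λ i∈t → i∉s (there i∈t)) (shiftTop-<⁻ inside i<top))

module Levels (k' : ℕ) where
  k : ℕ
  k = suc k'

  level : ℕ → ℕ
  level m = (m ∸ k) ⊓ k

  level<k+1 : ∀ m → level m < k + 1
  level<k+1 m = ≤-<-trans (m⊓n≤n (m ∸ k) k) (m<m+n k (s≤s z≤n))

  level-low : ∀ {m} → m ≤ k + k' → level m ≡ m ∸ k
  level-low {m} m≤ = m≤n⇒m⊓n≡m (≤-trans (m≤n+o⇒m∸n≤o m k m≤) (n≤1+n k'))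

  level-low<k : ∀ {m} → m ≤ k + k' → level m < k
  level-low<k {m} m≤ = s≤s (subst (_≤ k') (sym (level-low m≤)) (m≤n+o⇒m∸n≤o m k m≤))

  level-high : ∀ {m} → k + k' < m → level m ≡ k
  level-high {m} k+k'<m =
    m≥n⇒m⊓n≡n (subst (_≤ m ∸ k) (m+n∸n≡m k k) (∸-monoˡ-≤ k (subst (_≤ m) (sym (+-suc k k')) k+k'<m)))

  level-low-injective : ∀ {m m'} → k ≤ m → m ≤ k + k' → k ≤ m' → level m' ≡ level m → m' ≡ m
  level-low-injective {m} {m'} k≤m m≤ k≤m' eq with m' ≤? k + k'
  ... | yes m'≤ = ∸-cancelʳ-≡ k≤m' k≤m (trans (sym (level-low m'≤)) (trans eq (level-low m≤)))
  ... | no  m'≰ = contradiction (trans (sym (level-high (≰⇒> m'≰))) eq) (>⇒≢ (level-low<k m≤))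

UniquelyColoured : ∀ {n k m} → (KVertex n k → Fin m) → KVertex n k → KVertex n k → Set
UniquelyColoured {n} {k} C v u =
  InClosedNbhd u v × ((w : KVertex n k) → InClosedNbhd w v → C w ≡ C u → w ≈V u)

uniquelyColoured⇒CFCN : ∀ {n k m} (C : KVertex n k → Fin m) →
  ((v : KVertex n k) → ∃ (UniquelyColoured C v)) → IsCFCNColoring C
uniquelyColoured⇒CFCN C witness v with witness v
... | u , u∈N[v] , unique = C u , u , u∈N[v] , refl , unique

module Construction (n k' : ℕ) where
  open Levels k'

  colour : KVertex n k → Fin (k + 1)
  colour (s , _) = fromℕ< (level<k+1 (top s))

  colour-level : ∀ u w → colour u ≡ colour w → level (top (proj₁ u)) ≡ level (top (proj₁ w))
  colour-level (u , _) (w , _) = fromℕ<-injective _ _ (level<k+1 (top u)) (level<k+1 (top w))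

  k≤top : (u : KVertex n k) → k ≤ top (proj₁ u)
  k≤top (s , ∣s∣≡k) = subst (_≤ top s) ∣s∣≡k (∣∣≤top s)

  low-vertex : ∀ v → top (proj₁ v) ≤ k + k' → UniquelyColoured colour v v
  low-vertex v low = inj₁ refl , unique
    where
    unique : ∀ w → InClosedNbhd w v → colour w ≡ colour v → w ≈V v
    unique w (inj₁ w≈v) _ = w≈v
    unique w (inj₂ w∩v≡∅) same =
      contradiction (level-low-injective (k≤top v) low (k≤top w) (colour-level w v same))
                    (disjoint⇒top≢ w∩v≡∅ (≤-trans (s≤s z≤n) (k≤top v)))

  high-vertex : ∀ v → k + k' < top (proj₁ v) → ∃ (UniquelyColoured colour v)
  high-vertex (v , ∣v∣≡k) high = W , inj₂ (lowest-disjoint k v) , unique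
    where
    -- top v ≥ 2k, so among the first 2k−1 positions v leaves at least k gaps.
    enough-gaps : k ≤ gaps (k + k') v
    enough-gaps = +-cancelˡ-≤ k k (gaps (k + k') v)
      (subst₂ (λ x y → x ≤ y + gaps (k + k') v) (sym (+-suc k k')) ∣v∣≡k
        (<top⇒<∣∣+gaps (k + k') v high))
    fits : ∣ lowest k v ∣ ≡ k × top (lowest k v) ≤ k + k'
    fits = lowest-fits (k + k') k v enough-gaps
    W : KVertex n k
    W = lowest k v , proj₁ fits
    unique : ∀ w → InClosedNbhd w (v , ∣v∣≡k) → colour w ≡ colour W → w ≈V W
    unique w (inj₁ refl) same =
      contradiction (trans (sym (level-high high)) (colour-level w W same)) (>⇒≢ (level-low<k (proj₂ fits)))
    unique (w , ∣w∣≡k) (inj₂ w∩v≡∅) same = ⊆∧∣∣≡⇒≡ w⊆W (trans ∣w∣≡k (sym (proj₁ fits)))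
      where
      same-top : top w ≡ top (lowest k v)
      same-top = level-low-injective (k≤top W) (proj₂ fits) (k≤top (w , ∣w∣≡k)) (colour-level (w , ∣w∣≡k) W same)
      w⊆W : w ⊆ lowest k v
      w⊆W {i} i∈w = lowest-initial k v (λ i∈v → w∩v≡∅ (i , x∈p∩q⁺ (i∈w , i∈v)))
                      (subst (toℕ i <_) same-top (∈⇒<top i∈w))

  colour-CFCN : IsCFCNColoring colour
  colour-CFCN = uniquelyColoured⇒CFCN colour witness
    where
    witness : ∀ v → ∃ (UniquelyColoured colour v)
    witness v with top (proj₁ v) ≤? k + k'
    ... | yes low = v , low-vertex v low
    ... | no  high = high-vertex v (≰⇒> high)

lemma8 : (n k : ℕ) → 1 ≤ k → 2 * k + 1 ≤ n → χCFCN-K≤ n k (k + 1)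
lemma8 n (suc k') _ _ = colour , colour-CFCN
  where open Construction n k'
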